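{- Let $A\in\mathcal S^n$ be a nonnegative Robinsonian matrix, let $\sigma$ be an SFS ordering of $A$, and let $x,y,z$ be distinct elements with $x<_\sigma y<_\sigma z$. Then: (i) $A_{xy}\ge\min\{A_{xz},A_{yz}\}$; (ii) if $x<_\pi z<_\pi y$ for some Robinson ordering $\pi$ of $A$, then the path $(x,z)$ does not avoid $y$, i.e., $A_{xz}\le\min\{A_{xy},A_{yz}\}$.
   Context: $\mathcal S^n$: real symmetric $n\times n$ matrices indexed by $V=[n]$; diagonal entries play no role. A linear order $\pi$ of $V$ is a Robinson ordering of $A$ if $A_{xz}\le\min\{A_{xy},A_{yz}\}$ for all $x<_\pi y<_\pi z$; $A$ is Robinsonian if it has one. A path $(x,z)$ avoids $y$ if $A_{xz}>\min\{A_{yx},A_{yz}\}$. Similarity partition: for $p\in V$ and $U\subseteq V\setminus\{p\}$, let $N_U(p)=\{y\in U:A_{py}>0\}$, let $a_1>\dots>a_s>0$ be the distinct values $A_{py}$, $y\in N_U(p)$, and $C_i=\{y\in N_U(p):A_{py}=a_i\}$; the similarity partition is $(C_1,\dots,C_s)$. Refining an ordered partition $(B_1,\dots,B_r)$ of $U$ by $(C_1,\dots,C_s)$ replaces each $B_j$ by $(B_j\cap C_1,\dots,B_j\cap C_s,B_j\setminus(C_1\cup\dots\cup C_s))$ and deletes empty classes. SFS algorithm: start with queue $\phi=(V)$. For $i=1,\dots,n$: let $S$ be the first class of $\phi$; choose a pivot $p\in S$ arbitrarily; put $p$ at position $i$ of the output order; remove $p$ from $\phi$; with $U$ the set of vertices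 remaining in $\phi$, refine $\phi$ by the similarity partition of $N_U(p)$. Any possible output is an SFS ordering of $A$.
   Formalization: The entries of the matrix A are rational instead of real. -}

module Defs where

open import Data.Nat using (ℕ)
open import Data.Fin using (Fin)
open import Data.Fin.Properties using () renaming (_≟_ to _≟ᶠ_)
open import Data.List using (List; []; _∷_; _++_; filter; map; reverse; deduplicate; concatMap; allFin)
open import Data.List.Membership.Propositional using (_∈_)
open import Data.List.Relation.Binary.Permutation.Propositional using (_↭_)
open import Data.Product using (Σ; ∃; ∃-syntax; _×_; _,_)
open import Data.Rational using (ℚ; 0ℚ; _≤_; _⊓_)
open import Data.Rational.Properties using (_≟_; _<?_; ≤-decTotalOrder)
open import Relation.Binary.PropositionalEquality using (_≡_)
open import Relation.Nullary using (¬_; ¬?)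
import Data.List.Sort.InsertionSort.Base as ISort

Matrix : ℕ → Set
Matrix n = Fin n → Fin n → ℚ

Symmetric : ∀ {n} → Matrix n → Set
Symmetric A = ∀ i j → A i j ≡ A j i

Nonnegative : ∀ {n} → Matrix n → Set
Nonnegative A = ∀ i j → 0ℚ ≤ A i j

-- Linear orders of V are represented as lists enumerating V exactly once
-- (a permutation of allFin n); x <_σ y means x occurs before y in σ.

IsLinearOrder : ∀ {n} → List (Fin n) → Set
IsLinearOrder {n} σ = σ ↭ allFin n

_⟨_⟩<_ : ∀ {n} → Fin n → List (Fin n) → Fin n → Set
x ⟨ σ ⟩< y = ∃[ l₁ ] ∃[ l₂ ] ∃[ l₃ ] (σ ≡ l₁ ++ x ∷ l₂ ++ y ∷ l₃)

IsRobinsonOrdering : ∀ {n} → Matrix n → List (Fin n) → Set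
IsRobinsonOrdering A π =
  IsLinearOrder π ×
  (∀ x y z → x ⟨ π ⟩< y → y ⟨ π ⟩< z → A x z ≤ A x y ⊓ A y z)

Robinsonian : ∀ {n} → Matrix n → Set
Robinsonian A = ∃[ π ] IsRobinsonOrdering A π

-- ordered partitions (queues) are lists of classes, each a list of vertices
Queue : ℕ → Set
Queue n = List (List (Fin n))

dropEmpty : ∀ {n} → Queue n → Queue n
dropEmpty [] = []
dropEmpty ([] ∷ q) = dropEmpty q
dropEmpty ((x ∷ xs) ∷ q) = (x ∷ xs) ∷ dropEmpty q

sortDesc : List ℚ → List ℚ
sortDesc vs = reverse (ISort.sort ≤-decTotalOrder (deduplicate _≟_ vs))

-- Refinement of one class B by the similarity partition of pivot p:
-- (B ∩ C₁, …, B ∩ C_s, B ∖ (C₁ ∪ … ∪ C_s)), where C_i = {y : A p y = a_i}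
-- and a₁ > … > a_s > 0 are the distinct positive values A p y.
-- (Computing the a_i from B only is harmless, as empty classes are deleted.)
refineClass : ∀ {n} → Matrix n → Fin n → List (Fin n) → Queue n
refineClass A p B =
  map (λ a → filter (λ y → A p y ≟ a) B)
      (sortDesc (filter (λ v → 0ℚ <? v) (map (A p) B)))
  ++ (filter (λ y → ¬? (0ℚ <? A p y)) B ∷ [])

refine : ∀ {n} → Matrix n → Fin n → Queue n → Queue n
refine A p q = dropEmpty (concatMap (refineClass A p) q)

remove : ∀ {n} → Fin n → List (Fin n) → List (Fin n)
remove p S = filter (λ y → ¬? (y ≟ᶠ p)) S

-- SFSRun A φ σ : starting from queue φ, the SFS algorithm can output σ
-- (pivot p chosen arbitrarily from the first class S).
data SFSRun {n} (A : Matrix n) : Queue n → List (Fin n) → Set where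
  done : SFSRun A [] []
  step : ∀ {S φ σ} p → p ∈ S →
         SFSRun A (refine A p (remove p S ∷ φ)) σ →
         SFSRun A (S ∷ φ) (p ∷ σ)

initialQueue : (n : ℕ) → Queue n
initialQueue n = dropEmpty (allFin n ∷ [])

IsSFSOrdering : ∀ {n} → Matrix n → List (Fin n) → Set
IsSFSOrdering {n} A σ = SFSRun A (initialQueue n) σ

{-# OPTIONS --safe #-}
module Submission where

-- Fix a Robinson ordering π. Along an SFS run the queue never gives a vertex c two predecessors
-- lying on opposite sides of c in π: the pivot p precedes every vertex outside the first class,
-- and refining by p moves d ahead of c only if A p d > A p c, which the Robinson property forbids
-- when c lies between p and d. Now let x <σ y <σ z with z between x and y in π, and consider the
-- step with pivot x. Then y cannot precede z in the queue, since x, lying in the first class,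
-- precedes z as well. So z precedes y or shares its class, and if A x z > A x y, then z precedes
-- y after refining by x, contradicting y <σ z. Hence A x z ≤ A x y.
-- Both parts follow from this and the Robinson inequalities, according to which of x, y, z lies
-- between the other two in π.

open import Defs
open import Data.Nat using (ℕ)
open import Data.Fin using (Fin)
open import Data.List using (List)
open import Data.Product using (_×_)
open import Data.Rational using (_≤_; _⊓_)
open import Relation.Binary.PropositionalEquality using (_≢_)

open import Data.List using ([]; _∷_; _++_; filter; map; reverse; deduplicate; concatMap; allFin)
open import Data.List.Properties using (unfold-reverse)
open import Data.List.Membership.Propositional using (_∈_)
open import Data.List.Membership.Propositional.Properties
  using (∈-filter⁺; ∈-filter⁻; ∈-map⁺; ∈-∃++; ∈-++⁺ʳ; ∈-allFin; ∈-deduplicate⁺; ∈-deduplicate⁻)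
import Data.List.Membership.DecPropositional as DecMembership
open import Data.List.Relation.Unary.Any as Any using (Any; here; there)
import Data.List.Relation.Unary.Any.Properties as Any
open import Data.List.Relation.Unary.All as All using (All; []; _∷_)
open import Data.List.Relation.Unary.AllPairs as AllPairs using (AllPairs; []; _∷_)
import Data.List.Relation.Unary.AllPairs.Properties as AllPairs
open import Data.List.Relation.Unary.Linked.Properties using (Linked⇒AllPairs)
open import Data.List.Relation.Unary.Unique.DecPropositional.Properties using (deduplicate-!)
open import Data.List.Relation.Binary.Permutation.Propositional using (↭-sym; ↭⇒↭ₛ)
open import Data.List.Relation.Binary.Permutation.Propositional.Properties using (∈-resp-↭)
open import Data.List.Relation.Binary.Permutation.Setoid.Properties using (Unique-resp-↭)
import Data.List.Sort.InsertionSort.Base as InsertionSort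
open import Data.List.Sort.InsertionSort.Properties using (sort-↗; sort-↭)
open import Data.Rational using (ℚ; 0ℚ; _<_; _>_)
open import Data.Rational.Properties
  using (_≟_; _<?_; ≤-decTotalOrder; ≤-trans; ≤-antisym; ≰⇒>; ≮⇒≥; <-irrefl; <-asym; ≤-<-trans; <-≤-trans; p⊓q≤p; p⊓q≤q; ⊓-glb)
open import Data.Fin.Properties using () renaming (_≟_ to _≟ᶠ_)
open import Data.Product as Product using (_,_; proj₁; proj₂)
open import Data.Sum as Sum using (_⊎_; inj₁; inj₂)
open import Data.Empty using (⊥; ⊥-elim)
open import Function using (flip; _∘_)
open import Relation.Binary.PropositionalEquality using (_≡_; refl; sym; subst; subst₂; setoid)
open import Relation.Nullary using (¬_; yes; no; ¬?; contradiction)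

AllPairs-reverse⁺ : ∀ {a ℓ} {X : Set a} {R : X → X → Set ℓ} {xs : List X} →
                    AllPairs R xs → AllPairs (flip R) (reverse xs)
AllPairs-reverse⁺ [] = []
AllPairs-reverse⁺ {xs = x ∷ xs} (Rx ∷ Rxs) rewrite unfold-reverse x xs =
  AllPairs.++⁺ (AllPairs-reverse⁺ Rxs) (All.[] ∷ [])
               (All.tabulate (λ y∈ → All.lookup Rx (Any.reverse⁻ y∈) ∷ []))

sortDesc-strictlyDecreasing : ∀ vs → AllPairs _>_ (sortDesc vs)
sortDesc-strictlyDecreasing vs = AllPairs-reverse⁺ (AllPairs.zipWith ≤∧≢⇒< (sorted , unique))
  where
  ascending : List ℚ
  ascending = InsertionSort.sort ≤-decTotalOrder (deduplicate _≟_ vs)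

  sorted : AllPairs _≤_ ascending
  sorted = Linked⇒AllPairs ≤-trans (sort-↗ ≤-decTotalOrder (deduplicate _≟_ vs))

  unique : AllPairs _≢_ ascending
  unique = Unique-resp-↭ (setoid ℚ) (↭⇒↭ₛ (↭-sym (sort-↭ ≤-decTotalOrder _))) (deduplicate-! _≟_ vs)

  ≤∧≢⇒< : ∀ {a b} → a ≤ b × a ≢ b → a < b
  ≤∧≢⇒< (a≤b , a≢b) = ≰⇒> (λ b≤a → a≢b (≤-antisym a≤b b≤a))

∈-sortDesc⁻ : ∀ vs {a} → a ∈ sortDesc vs → a ∈ vs
∈-sortDesc⁻ vs a∈ =
  ∈-deduplicate⁻ _≟_ vs (∈-resp-↭ (sort-↭ ≤-decTotalOrder (deduplicate _≟_ vs)) (Any.reverse⁻ a∈))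

∈-sortDesc⁺ : ∀ {vs a} → a ∈ vs → a ∈ sortDesc vs
∈-sortDesc⁺ {vs} a∈ =
  Any.reverse⁺ (∈-resp-↭ (↭-sym (sort-↭ ≤-decTotalOrder (deduplicate _≟_ vs))) (∈-deduplicate⁺ _≟_ a∈))

module _ {n : ℕ} where

  ⟨⟩<⇒∈ˡ : ∀ {σ : List (Fin n)} {x y} → x ⟨ σ ⟩< y → x ∈ σ
  ⟨⟩<⇒∈ˡ (l₁ , _ , _ , refl) = ∈-++⁺ʳ l₁ (here refl)

  ⟨⟩<⇒∈ʳ : ∀ {σ : List (Fin n)} {x y} → x ⟨ σ ⟩< y → y ∈ σ
  ⟨⟩<⇒∈ʳ (l₁ , l₂ , _ , refl) = ∈-++⁺ʳ l₁ (there (∈-++⁺ʳ l₂ (here refl)))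

  ⟨∷⟩<⁺ : ∀ {σ : List (Fin n)} {w x y} → x ⟨ σ ⟩< y → x ⟨ w ∷ σ ⟩< y
  ⟨∷⟩<⁺ {w = w} (l₁ , l₂ , l₃ , refl) = w ∷ l₁ , l₂ , l₃ , refl

  ⟨∷⟩<⁻ : ∀ {σ : List (Fin n)} {p x y} → x ⟨ p ∷ σ ⟩< y → (x ≡ p × y ∈ σ) ⊎ x ⟨ σ ⟩< y
  ⟨∷⟩<⁻ ([] , l₂ , _ , refl) = inj₁ (refl , ∈-++⁺ʳ l₂ (here refl))
  ⟨∷⟩<⁻ (_ ∷ l₁ , l₂ , l₃ , refl) = inj₂ (l₁ , l₂ , l₃ , refl)

  ⟨⟩<-total : ∀ {σ : List (Fin n)} {x y} → x ∈ σ → y ∈ σ → x ≢ y → x ⟨ σ ⟩< y ⊎ y ⟨ σ ⟩< x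
  ⟨⟩<-total (here refl) (here refl) x≢y = contradiction refl x≢y
  ⟨⟩<-total (here refl) (there y∈) _ with l₂ , l₃ , refl ← ∈-∃++ y∈ = inj₁ ([] , l₂ , l₃ , refl)
  ⟨⟩<-total (there x∈) (here refl) _ with l₂ , l₃ , refl ← ∈-∃++ x∈ = inj₂ ([] , l₂ , l₃ , refl)
  ⟨⟩<-total (there x∈) (there y∈) x≢y = Sum.map ⟨∷⟩<⁺ ⟨∷⟩<⁺ (⟨⟩<-total x∈ y∈ x≢y)

module _ {n : ℕ} where

  infix 4 _∈ᵠ_ _≺[_]_ _∼[_]_

  _∈ᵠ_ : Fin n → Queue n → Set
  u ∈ᵠ φ = Any (u ∈_) φ

  data _≺[_]_ : Fin n → Queue n → Fin n → Set where
    ≺-here  : ∀ {u v C φ} → u ∈ C → v ∈ᵠ φ → u ≺[ C ∷ φ ] v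
    ≺-there : ∀ {u v C φ} → u ≺[ φ ] v → u ≺[ C ∷ φ ] v

  _∼[_]_ : Fin n → Queue n → Fin n → Set
  u ∼[ φ ] v = Any (λ C → u ∈ C × v ∈ C) φ

  -- u ≺[ φ ] u holds exactly when u occurs in two different classes of φ.
  ClassesDisjoint : Queue n → Set
  ClassesDisjoint φ = ∀ {u} → ¬ u ≺[ φ ] u

  ≺⇒∈ᵠˡ : ∀ {φ u v} → u ≺[ φ ] v → u ∈ᵠ φ
  ≺⇒∈ᵠˡ (≺-here u∈ _) = here u∈
  ≺⇒∈ᵠˡ (≺-there u≺v) = there (≺⇒∈ᵠˡ u≺v)

  ≺⇒∈ᵠʳ : ∀ {φ u v} → u ≺[ φ ] v → v ∈ᵠ φ
  ≺⇒∈ᵠʳ (≺-here _ v∈) = there v∈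
  ≺⇒∈ᵠʳ (≺-there u≺v) = there (≺⇒∈ᵠʳ u≺v)

  ≺-∷-first : ∀ {C φ u v w} → w ∈ C → u ≺[ C ∷ φ ] v → w ≺[ C ∷ φ ] v
  ≺-∷-first w∈ (≺-here _ v∈) = ≺-here w∈ v∈
  ≺-∷-first w∈ (≺-there u≺v) = ≺-here w∈ (≺⇒∈ᵠʳ u≺v)

  ≺-trichotomy : ∀ φ {u v} → u ∈ᵠ φ → v ∈ᵠ φ → u ≺[ φ ] v ⊎ u ∼[ φ ] v ⊎ v ≺[ φ ] u
  ≺-trichotomy (C ∷ φ) {u} {v} u∈ v∈ with u ∈? C | v ∈? C
    where open DecMembership _≟ᶠ_
  ... | yes u∈C | yes v∈C = inj₂ (inj₁ (here (u∈C , v∈C)))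
  ... | yes u∈C | no v∉C  = inj₁ (≺-here u∈C (Any.tail v∉C v∈))
  ... | no u∉C  | yes v∈C = inj₂ (inj₂ (≺-here v∈C (Any.tail u∉C u∈)))
  ... | no u∉C  | no v∉C  =
    Sum.map ≺-there (Sum.map there ≺-there) (≺-trichotomy φ (Any.tail u∉C u∈) (Any.tail v∉C v∈))

  Any-mapHead : ∀ {P : List (Fin n) → Set} {C D φ} → (P C → P D) → Any P (C ∷ φ) → Any P (D ∷ φ)
  Any-mapHead f (here pC) = here (f pC)
  Any-mapHead f (there pφ) = there pφ

  ≺-mapHead : ∀ {C D φ u v} → (u ∈ C → u ∈ D) → u ≺[ C ∷ φ ] v → u ≺[ D ∷ φ ] v
  ≺-mapHead f (≺-here u∈ v∈) = ≺-here (f u∈) v∈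
  ≺-mapHead f (≺-there u≺v) = ≺-there u≺v

  ≺-++⁻ : ∀ ψ₁ {ψ₂ u v} → u ≺[ ψ₁ ++ ψ₂ ] v →
          u ≺[ ψ₁ ] v ⊎ (u ∈ᵠ ψ₁ × v ∈ᵠ ψ₂) ⊎ u ≺[ ψ₂ ] v
  ≺-++⁻ [] u≺v = inj₂ (inj₂ u≺v)
  ≺-++⁻ (C ∷ ψ₁) (≺-here u∈ v∈) with Any.++⁻ ψ₁ v∈
  ... | inj₁ v∈ψ₁ = inj₁ (≺-here u∈ v∈ψ₁)
  ... | inj₂ v∈ψ₂ = inj₂ (inj₁ (here u∈ , v∈ψ₂))
  ≺-++⁻ (C ∷ ψ₁) (≺-there u≺v) =
    Sum.map ≺-there (Sum.map₁ (Product.map₁ there)) (≺-++⁻ ψ₁ u≺v)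

  ≺-++⁺ : ∀ ψ₁ {ψ₂ u v} → u ≺[ ψ₁ ] v ⊎ (u ∈ᵠ ψ₁ × v ∈ᵠ ψ₂) ⊎ u ≺[ ψ₂ ] v →
          u ≺[ ψ₁ ++ ψ₂ ] v
  ≺-++⁺ [] (inj₂ (inj₂ u≺v)) = u≺v
  ≺-++⁺ (C ∷ ψ₁) (inj₁ (≺-here u∈ v∈)) = ≺-here u∈ (Any.++⁺ˡ v∈)
  ≺-++⁺ (C ∷ ψ₁) (inj₁ (≺-there u≺v)) = ≺-there (≺-++⁺ ψ₁ (inj₁ u≺v))
  ≺-++⁺ (C ∷ ψ₁) (inj₂ (inj₁ (here u∈ , v∈))) = ≺-here u∈ (Any.++⁺ʳ ψ₁ v∈)
  ≺-++⁺ (C ∷ ψ₁) (inj₂ (inj₁ (there u∈ , v∈))) = ≺-there (≺-++⁺ ψ₁ (inj₂ (inj₁ (u∈ , v∈))))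
  ≺-++⁺ (C ∷ ψ₁) (inj₂ (inj₂ u≺v)) = ≺-there (≺-++⁺ ψ₁ (inj₂ (inj₂ u≺v)))

  ∈ᵠ-dropEmpty⁻ : ∀ ψ {u} → u ∈ᵠ dropEmpty ψ → u ∈ᵠ ψ
  ∈ᵠ-dropEmpty⁻ ([] ∷ ψ) u∈ = there (∈ᵠ-dropEmpty⁻ ψ u∈)
  ∈ᵠ-dropEmpty⁻ ((_ ∷ _) ∷ ψ) (here u∈) = here u∈
  ∈ᵠ-dropEmpty⁻ ((_ ∷ _) ∷ ψ) (there u∈) = there (∈ᵠ-dropEmpty⁻ ψ u∈)

  ∈ᵠ-dropEmpty⁺ : ∀ ψ {u} → u ∈ᵠ ψ → u ∈ᵠ dropEmpty ψ
  ∈ᵠ-dropEmpty⁺ ([] ∷ ψ) (there u∈) = ∈ᵠ-dropEmpty⁺ ψ u∈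
  ∈ᵠ-dropEmpty⁺ ((_ ∷ _) ∷ ψ) (here u∈) = here u∈
  ∈ᵠ-dropEmpty⁺ ((_ ∷ _) ∷ ψ) (there u∈) = there (∈ᵠ-dropEmpty⁺ ψ u∈)

  ≺-dropEmpty⁻ : ∀ ψ {u v} → u ≺[ dropEmpty ψ ] v → u ≺[ ψ ] v
  ≺-dropEmpty⁻ ([] ∷ ψ) u≺v = ≺-there (≺-dropEmpty⁻ ψ u≺v)
  ≺-dropEmpty⁻ ((_ ∷ _) ∷ ψ) (≺-here u∈ v∈) = ≺-here u∈ (∈ᵠ-dropEmpty⁻ ψ v∈)
  ≺-dropEmpty⁻ ((_ ∷ _) ∷ ψ) (≺-there u≺v) = ≺-there (≺-dropEmpty⁻ ψ u≺v)

  ≺-dropEmpty⁺ : ∀ ψ {u v} → u ≺[ ψ ] v → u ≺[ dropEmpty ψ ] v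
  ≺-dropEmpty⁺ ([] ∷ ψ) (≺-there u≺v) = ≺-dropEmpty⁺ ψ u≺v
  ≺-dropEmpty⁺ ((_ ∷ _) ∷ ψ) (≺-here u∈ v∈) = ≺-here u∈ (∈ᵠ-dropEmpty⁺ ψ v∈)
  ≺-dropEmpty⁺ ((_ ∷ _) ∷ ψ) (≺-there u≺v) = ≺-there (≺-dropEmpty⁺ ψ u≺v)

  ≺-dropEmpty-singleton : ∀ C {u v} → ¬ u ≺[ dropEmpty (C ∷ []) ] v
  ≺-dropEmpty-singleton C u≺v with ≺-dropEmpty⁻ (C ∷ []) u≺v
  ... | ≺-here _ ()
  ... | ≺-there ()

  module ConcatMap (f : List (Fin n) → Queue n)
           (∈ᵠ-f⁻ : ∀ {B u} → u ∈ᵠ f B → u ∈ B) (∈ᵠ-f⁺ : ∀ {B u} → u ∈ B → u ∈ᵠ f B) where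

    ∈ᵠ-concatMap⁻ : ∀ {ψ u} → u ∈ᵠ concatMap f ψ → u ∈ᵠ ψ
    ∈ᵠ-concatMap⁻ = Any.map ∈ᵠ-f⁻ ∘ Any.concatMap⁻ _

    ∈ᵠ-concatMap⁺ : ∀ {ψ u} → u ∈ᵠ ψ → u ∈ᵠ concatMap f ψ
    ∈ᵠ-concatMap⁺ = Any.concatMap⁺ _ ∘ Any.map ∈ᵠ-f⁺

    ≺-concatMap⁻ : ∀ ψ {u v} → u ≺[ concatMap f ψ ] v → u ≺[ ψ ] v ⊎ Any (λ B → u ≺[ f B ] v) ψ
    ≺-concatMap⁻ (B ∷ ψ) u≺v with ≺-++⁻ (f B) u≺v
    ... | inj₁ u≺v∈B = inj₂ (here u≺v∈B)
    ... | inj₂ (inj₁ (u∈ , v∈)) = inj₁ (≺-here (∈ᵠ-f⁻ u∈) (∈ᵠ-concatMap⁻ v∈))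
    ... | inj₂ (inj₂ u≺v∈ψ) = Sum.map ≺-there there (≺-concatMap⁻ ψ u≺v∈ψ)

    ≺-concatMap⁺ : ∀ ψ {u v} → u ≺[ ψ ] v ⊎ Any (λ B → u ≺[ f B ] v) ψ → u ≺[ concatMap f ψ ] v
    ≺-concatMap⁺ (B ∷ ψ) (inj₁ (≺-here u∈ v∈)) = ≺-++⁺ (f B) (inj₂ (inj₁ (∈ᵠ-f⁺ u∈ , ∈ᵠ-concatMap⁺ v∈)))
    ≺-concatMap⁺ (B ∷ ψ) (inj₁ (≺-there u≺v)) = ≺-++⁺ (f B) (inj₂ (inj₂ (≺-concatMap⁺ ψ (inj₁ u≺v))))
    ≺-concatMap⁺ (B ∷ ψ) (inj₂ (here u≺v)) = ≺-++⁺ (f B) (inj₁ u≺v)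
    ≺-concatMap⁺ (B ∷ ψ) (inj₂ (there u≺v)) = ≺-++⁺ (f B) (inj₂ (inj₂ (≺-concatMap⁺ ψ (inj₂ u≺v))))

module ClassRefinement {n : ℕ} (A : Matrix n) (p : Fin n) (B : List (Fin n)) where

  private
    level : ℚ → List (Fin n)
    level a = filter (λ y → A p y ≟ a) B

    nonpositive : List (Fin n)
    nonpositive = filter (λ y → ¬? (0ℚ <? A p y)) B

    -- refineClass A p B unfolds to classes levels.
    classes : List ℚ → Queue n
    classes as = map level as ++ nonpositive ∷ []

    positiveValues : List ℚ
    positiveValues = filter (0ℚ <?_) (map (A p) B)

    levels : List ℚ
    levels = sortDesc positiveValues

    levels-positive : All (0ℚ <_) levels
    levels-positive =
      All.tabulate (λ a∈ → proj₂ (∈-filter⁻ (0ℚ <?_) {xs = map (A p) B} (∈-sortDesc⁻ positiveValues a∈)))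

    ∈-levels : ∀ {u} → u ∈ B → 0ℚ < A p u → A p u ∈ levels
    ∈-levels u∈ pos = ∈-sortDesc⁺ (∈-filter⁺ (0ℚ <?_) (∈-map⁺ (A p) u∈) pos)

    ∈ᵠ-classes⁻ : ∀ as {u} → u ∈ᵠ classes as → u ∈ B × (A p u ∈ as ⊎ ¬ 0ℚ < A p u)
    ∈ᵠ-classes⁻ [] (here u∈) = Product.map₂ inj₂ (∈-filter⁻ (λ y → ¬? (0ℚ <? A p y)) u∈)
    ∈ᵠ-classes⁻ (a ∷ as) (here u∈) = Product.map₂ (inj₁ ∘ here) (∈-filter⁻ (λ y → A p y ≟ a) u∈)
    ∈ᵠ-classes⁻ (a ∷ as) (there u∈) = Product.map₂ (Sum.map₁ there) (∈ᵠ-classes⁻ as u∈)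

    ∈ᵠ-classes⁺ : ∀ as {u} → u ∈ B → (0ℚ < A p u → A p u ∈ as) → u ∈ᵠ classes as
    ∈ᵠ-classes⁺ [] {u} u∈ ∈as with 0ℚ <? A p u
    ... | yes pos = contradiction (∈as pos) λ ()
    ... | no ¬pos = here (∈-filter⁺ (λ y → ¬? (0ℚ <? A p y)) u∈ ¬pos)
    ∈ᵠ-classes⁺ (a ∷ as) {u} u∈ ∈as with A p u ≟ a
    ... | yes refl = here (∈-filter⁺ (λ y → A p y ≟ a) u∈ refl)
    ... | no ≢a = there (∈ᵠ-classes⁺ as u∈ (Any.tail ≢a ∘ ∈as))

    ≺-classes⁻ : ∀ as → All (0ℚ <_) as → AllPairs _>_ as → ∀ {u v} → u ≺[ classes as ] v → A p v < A p u
    ≺-classes⁻ [] _ _ (≺-here _ ())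
    ≺-classes⁻ [] _ _ (≺-there ())
    ≺-classes⁻ (a ∷ as) (0<a ∷ _) (a>as ∷ _) (≺-here u∈ v∈)
      with refl ← proj₂ (∈-filter⁻ (λ y → A p y ≟ a) {xs = B} u∈) | proj₂ (∈ᵠ-classes⁻ as v∈)
    ... | inj₁ v∈as = All.lookup a>as v∈as
    ... | inj₂ ¬pos = ≤-<-trans (≮⇒≥ ¬pos) 0<a
    ≺-classes⁻ (a ∷ as) (_ ∷ as-pos) (_ ∷ as-desc) (≺-there u≺v) = ≺-classes⁻ as as-pos as-desc u≺v

    ≺-classes⁺ : ∀ as → AllPairs _>_ as → ∀ {u v} → u ∈ B → v ∈ B → A p u ∈ as →
                 (0ℚ < A p v → A p v ∈ as) → A p v < A p u → u ≺[ classes as ] v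
    ≺-classes⁺ (a ∷ as) _ u∈ v∈ (here refl) ∈as lt =
      ≺-here (∈-filter⁺ (λ y → A p y ≟ a) u∈ refl) (∈ᵠ-classes⁺ as v∈ (Any.tail (λ e → <-irrefl e lt) ∘ ∈as))
    ≺-classes⁺ (a ∷ as) (a>as ∷ as-desc) {u} {v} u∈ v∈ (there Apu∈as) ∈as lt =
      ≺-there (≺-classes⁺ as as-desc u∈ v∈ Apu∈as (Any.tail Apv≢a ∘ ∈as) lt)
      where
      Apv≢a : A p v ≢ a
      Apv≢a Apv≡a = <-asym lt (subst (A p u <_) (sym Apv≡a) (All.lookup a>as Apu∈as))

  ∈ᵠ-refineClass⁻ : ∀ {u} → u ∈ᵠ refineClass A p B → u ∈ B
  ∈ᵠ-refineClass⁻ = proj₁ ∘ ∈ᵠ-classes⁻ levels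

  ∈ᵠ-refineClass⁺ : ∀ {u} → u ∈ B → u ∈ᵠ refineClass A p B
  ∈ᵠ-refineClass⁺ u∈ = ∈ᵠ-classes⁺ levels u∈ (∈-levels u∈)

  ≺-refineClass⁻ : ∀ {u v} → u ≺[ refineClass A p B ] v → (u ∈ B × v ∈ B) × A p v < A p u
  ≺-refineClass⁻ u≺v =
    (∈ᵠ-refineClass⁻ (≺⇒∈ᵠˡ u≺v) , ∈ᵠ-refineClass⁻ (≺⇒∈ᵠʳ u≺v)) ,
    ≺-classes⁻ levels levels-positive (sortDesc-strictlyDecreasing positiveValues) u≺v

  ≺-refineClass⁺ : ∀ {u v} → u ∈ B → v ∈ B → 0ℚ ≤ A p v → A p v < A p u → u ≺[ refineClass A p B ] v
  ≺-refineClass⁺ u∈ v∈ 0≤Apv lt =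
    ≺-classes⁺ levels (sortDesc-strictlyDecreasing positiveValues) u∈ v∈
               (∈-levels u∈ (≤-<-trans 0≤Apv lt)) (∈-levels v∈) lt

module Refinement {n : ℕ} (A : Matrix n) (p : Fin n) where

  open ClassRefinement A p
  open ConcatMap (refineClass A p) (∈ᵠ-refineClass⁻ _) (∈ᵠ-refineClass⁺ _)

  ∈ᵠ-refine⁻ : ∀ ψ {u} → u ∈ᵠ refine A p ψ → u ∈ᵠ ψ
  ∈ᵠ-refine⁻ ψ = ∈ᵠ-concatMap⁻ {ψ} ∘ ∈ᵠ-dropEmpty⁻ _

  ≺-refine⁻ : ∀ ψ {u v} → u ≺[ refine A p ψ ] v → u ≺[ ψ ] v ⊎ (u ∼[ ψ ] v × A p v < A p u)
  ≺-refine⁻ ψ = Sum.map₂ withinClass ∘ ≺-concatMap⁻ ψ ∘ ≺-dropEmpty⁻ _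
    where
    withinClass : ∀ {u v} → Any (λ B → u ≺[ refineClass A p B ] v) ψ → u ∼[ ψ ] v × A p v < A p u
    withinClass u≺v = Any.map (proj₁ ∘ ≺-refineClass⁻ _) u≺v ,
                      let B , u≺v∈B = Any.satisfied u≺v in proj₂ (≺-refineClass⁻ B u≺v∈B)

  ≺-refine⁺ : ∀ ψ {u v} → 0ℚ ≤ A p v → u ≺[ ψ ] v ⊎ (u ∼[ ψ ] v × A p v < A p u) → u ≺[ refine A p ψ ] v
  ≺-refine⁺ ψ {u} {v} 0≤Apv = ≺-dropEmpty⁺ _ ∘ ≺-concatMap⁺ ψ ∘ Sum.map₂ withinClass
    where
    withinClass : u ∼[ ψ ] v × A p v < A p u → Any (λ B → u ≺[ refineClass A p B ] v) ψ
    withinClass (u∼v , lt) = Any.map (λ (u∈ , v∈) → ≺-refineClass⁺ _ u∈ v∈ 0≤Apv lt) u∼v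

module SFS {n : ℕ} (A : Matrix n) (nonneg : Nonnegative A) where

  pivotStep : Fin n → List (Fin n) → Queue n → Queue n
  pivotStep p S φ = refine A p (remove p S ∷ φ)

  module _ {p : Fin n} {S : List (Fin n)} {φ : Queue n} where

    open Refinement A p

    private
      removed⊆ : ∀ {w} → w ∈ remove p S → w ∈ S
      removed⊆ = proj₁ ∘ ∈-filter⁻ (λ y → ¬? (y ≟ᶠ p)) {xs = S}

      kept : ∀ {w} → w ≢ p → w ∈ S → w ∈ remove p S
      kept w≢p w∈ = ∈-filter⁺ (λ y → ¬? (y ≟ᶠ p)) w∈ w≢p

    ∈ᵠ-pivotStep⁻ : ∀ {u} → u ∈ᵠ pivotStep p S φ → u ∈ᵠ (S ∷ φ)
    ∈ᵠ-pivotStep⁻ = Any-mapHead removed⊆ ∘ ∈ᵠ-refine⁻ _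

    pivotStep-removes-pivot : p ∈ S → ClassesDisjoint (S ∷ φ) → ∀ {u} → u ∈ᵠ pivotStep p S φ → u ≢ p
    pivotStep-removes-pivot p∈S disjoint u∈ with ∈ᵠ-refine⁻ (remove p S ∷ φ) u∈
    ... | here u∈S = proj₂ (∈-filter⁻ (λ y → ¬? (y ≟ᶠ p)) {xs = S} u∈S)
    ... | there u∈φ = λ { refl → disjoint (≺-here p∈S u∈φ) }

    ≺-pivotStep⁻ : ∀ {u v} → u ≺[ pivotStep p S φ ] v → u ≺[ S ∷ φ ] v ⊎ (u ∼[ S ∷ φ ] v × A p v < A p u)
    ≺-pivotStep⁻ = Sum.map (≺-mapHead removed⊆) (Product.map₁ (Any-mapHead (Product.map removed⊆ removed⊆)))
                 ∘ ≺-refine⁻ _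

    ≺-pivotStep⁺ : ∀ {u v} → u ≢ p → v ≢ p → u ≺[ S ∷ φ ] v ⊎ (u ∼[ S ∷ φ ] v × A p v < A p u) →
                   u ≺[ pivotStep p S φ ] v
    ≺-pivotStep⁺ u≢p v≢p = ≺-refine⁺ _ (nonneg p _)
      ∘ Sum.map (≺-mapHead (kept u≢p)) (Product.map₁ (Any-mapHead (Product.map (kept u≢p) (kept v≢p))))

    pivotStep-disjoint : ClassesDisjoint (S ∷ φ) → ClassesDisjoint (pivotStep p S φ)
    pivotStep-disjoint disjoint u≺u with ≺-pivotStep⁻ u≺u
    ... | inj₁ u≺u′ = disjoint u≺u′
    ... | inj₂ (_ , lt) = <-irrefl refl lt

  ∈-sfs⇒∈ᵠ : ∀ {φ σ} → SFSRun A φ σ → ∀ {v} → v ∈ σ → v ∈ᵠ φ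
  ∈-sfs⇒∈ᵠ (step p p∈S run) (here refl) = here p∈S
  ∈-sfs⇒∈ᵠ (step p p∈S run) (there v∈) = ∈ᵠ-pivotStep⁻ (∈-sfs⇒∈ᵠ run v∈)

  sfs-tail-≢-pivot : ∀ {p S φ σ} → p ∈ S → ClassesDisjoint (S ∷ φ) → SFSRun A (pivotStep p S φ) σ →
                     ∀ {v} → v ∈ σ → v ≢ p
  sfs-tail-≢-pivot p∈S disjoint run = pivotStep-removes-pivot p∈S disjoint ∘ ∈-sfs⇒∈ᵠ run

  sfs-respects-≺ : ∀ {φ σ} → SFSRun A φ σ → ClassesDisjoint φ → ∀ {y z} → z ≺[ φ ] y → ¬ y ⟨ σ ⟩< z
  sfs-respects-≺ (step p p∈S run) disjoint z≺y y<z with ⟨∷⟩<⁻ y<z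
  ... | inj₁ (refl , _) = disjoint (≺-∷-first p∈S z≺y)
  ... | inj₂ y<z′ =
    sfs-respects-≺ run (pivotStep-disjoint disjoint)
      (≺-pivotStep⁺ (sfs-tail-≢-pivot p∈S disjoint run (⟨⟩<⇒∈ʳ y<z′))
                    (sfs-tail-≢-pivot p∈S disjoint run (⟨⟩<⇒∈ˡ y<z′)) (inj₁ z≺y)) y<z′

module _ {n : ℕ} where

  Between : List (Fin n) → Fin n → Fin n → Fin n → Set
  Between π a c b = (a ⟨ π ⟩< c × c ⟨ π ⟩< b) ⊎ (b ⟨ π ⟩< c × c ⟨ π ⟩< a)

  between-sym : ∀ {π a b c} → Between π a c b → Between π b c a
  between-sym = Sum.swap

  module _ {π : List (Fin n)} (linear : IsLinearOrder π) where

    private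
      ∈π : ∀ u → u ∈ π
      ∈π u = ∈-resp-↭ (↭-sym linear) (∈-allFin u)

    between-split : ∀ {p a b c} → p ≢ c → Between π a c b → Between π p c a ⊎ Between π p c b
    between-split {p} {c = c} p≢c a-c-b with ⟨⟩<-total (∈π p) (∈π c) p≢c | a-c-b
    ... | inj₁ p<c | inj₁ (_ , c<b) = inj₂ (inj₁ (p<c , c<b))
    ... | inj₂ c<p | inj₁ (a<c , _) = inj₁ (inj₂ (a<c , c<p))
    ... | inj₁ p<c | inj₂ (_ , c<a) = inj₁ (inj₁ (p<c , c<a))
    ... | inj₂ c<p | inj₂ (b<c , _) = inj₂ (inj₂ (b<c , c<p))

    between-trichotomy : ∀ {a b c} → a ≢ b → b ≢ c → a ≢ c →
                         Between π b a c ⊎ Between π a b c ⊎ Between π a c b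
    between-trichotomy {a} {b} {c} a≢b b≢c a≢c
      with ⟨⟩<-total (∈π a) (∈π b) a≢b | ⟨⟩<-total (∈π b) (∈π c) b≢c
    ... | inj₁ a<b | inj₁ b<c = inj₂ (inj₁ (inj₁ (a<b , b<c)))
    ... | inj₂ b<a | inj₂ c<b = inj₂ (inj₁ (inj₂ (c<b , b<a)))
    ... | inj₁ a<b | inj₂ c<b with ⟨⟩<-total (∈π a) (∈π c) a≢c
    ...   | inj₁ a<c = inj₂ (inj₂ (inj₁ (a<c , c<b)))
    ...   | inj₂ c<a = inj₁ (inj₂ (c<a , a<b))
    between-trichotomy {a} {b} {c} a≢b b≢c a≢c | inj₂ b<a | inj₁ b<c with ⟨⟩<-total (∈π a) (∈π c) a≢c
    ...   | inj₁ a<c = inj₁ (inj₁ (b<a , a<c))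
    ...   | inj₂ c<a = inj₂ (inj₂ (inj₂ (b<c , c<a)))

module RobinsonSFS {n : ℕ} (A : Matrix n) (symmetric : Symmetric A) (nonneg : Nonnegative A)
                   {π : List (Fin n)} (robinson : IsRobinsonOrdering A π) where

  open SFS A nonneg

  robinson-between : ∀ {a b c} → Between π a c b → A a b ≤ A a c
  robinson-between {a} {b} {c} (inj₁ (a<c , c<b)) = ≤-trans (proj₂ robinson a c b a<c c<b) (p⊓q≤p _ _)
  robinson-between {a} {b} {c} (inj₂ (b<c , c<a)) =
    subst₂ _≤_ (symmetric b a) (symmetric c a) (≤-trans (proj₂ robinson b c a b<c c<a) (p⊓q≤q (A b c) _))

  OneSided : Queue n → Set
  OneSided φ = ∀ {a c b} → Between π a c b → a ≺[ φ ] c → b ≺[ φ ] c → ⊥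

  pivotStep-oneSided : ∀ {p S φ} → p ∈ S → ClassesDisjoint (S ∷ φ) → OneSided (S ∷ φ) →
                       OneSided (pivotStep p S φ)
  pivotStep-oneSided {p} {S} {φ} p∈S disjoint oneSided {c = c} a-c-b a≺c b≺c =
    Sum.[ (λ p-c-a → notAcross p-c-a a≺c) , (λ p-c-b → notAcross p-c-b b≺c) ]
      (between-split (proj₁ robinson) (c≢p ∘ sym) a-c-b)
    where
    c≢p : c ≢ p
    c≢p = pivotStep-removes-pivot p∈S disjoint (≺⇒∈ᵠʳ a≺c)

    notAcross : ∀ {d} → Between π p c d → d ≺[ pivotStep p S φ ] c → ⊥
    notAcross p-c-d d≺c with ≺-pivotStep⁻ d≺c
    ... | inj₁ d≺c′ = oneSided p-c-d (≺-∷-first p∈S d≺c′) d≺c′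
    ... | inj₂ (_ , lt) = <-irrefl refl (<-≤-trans lt (robinson-between p-c-d))

  sfs-pivot-between : ∀ {p S φ σ y z} → p ∈ S → ClassesDisjoint (S ∷ φ) → OneSided (S ∷ φ) →
                      SFSRun A (pivotStep p S φ) σ → y ⟨ σ ⟩< z → Between π p z y → A p z ≤ A p y
  sfs-pivot-between {p} {S} {φ} {σ} {y} {z} p∈S disjoint oneSided run y<z p-z-y =
    ≮⇒≥ λ Apy<Apz → sfs-respects-≺ run (pivotStep-disjoint disjoint) (z≺y-after-pivot Apy<Apz) y<z
    where
    y∈ : y ∈ σ
    y∈ = ⟨⟩<⇒∈ˡ y<z

    z∈ : z ∈ σ
    z∈ = ⟨⟩<⇒∈ʳ y<z

    y≢p : y ≢ p
    y≢p = sfs-tail-≢-pivot p∈S disjoint run y∈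

    z≢p : z ≢ p
    z≢p = sfs-tail-≢-pivot p∈S disjoint run z∈

    z≺y-after-pivot : A p y < A p z → z ≺[ pivotStep p S φ ] y
    z≺y-after-pivot Apy<Apz
      with ≺-trichotomy (S ∷ φ) (∈ᵠ-pivotStep⁻ (∈-sfs⇒∈ᵠ run z∈)) (∈ᵠ-pivotStep⁻ (∈-sfs⇒∈ᵠ run y∈))
    ... | inj₁ z≺y = ≺-pivotStep⁺ z≢p y≢p (inj₁ z≺y)
    ... | inj₂ (inj₁ z∼y) = ≺-pivotStep⁺ z≢p y≢p (inj₂ (z∼y , Apy<Apz))
    ... | inj₂ (inj₂ y≺z) = ⊥-elim (oneSided p-z-y (≺-∷-first p∈S y≺z) y≺z)

  sfs-between : ∀ {φ σ} → SFSRun A φ σ → ClassesDisjoint φ → OneSided φ →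
                ∀ {x y z} → x ≢ y → x ⟨ σ ⟩< y → y ⟨ σ ⟩< z → Between π x z y → A x z ≤ A x y
  sfs-between done _ _ _ x<y _ _ = contradiction (⟨⟩<⇒∈ʳ x<y) λ ()
  sfs-between (step p p∈S run) disjoint oneSided x≢y x<y y<z x-z-y with ⟨∷⟩<⁻ x<y | ⟨∷⟩<⁻ y<z
  ... | inj₁ (refl , _) | inj₁ (refl , _) = contradiction refl x≢y
  ... | inj₁ (refl , _) | inj₂ y<z′ = sfs-pivot-between p∈S disjoint oneSided run y<z′ x-z-y
  ... | inj₂ x<y′ | inj₁ (refl , _) = contradiction refl (sfs-tail-≢-pivot p∈S disjoint run (⟨⟩<⇒∈ʳ x<y′))
  ... | inj₂ x<y′ | inj₂ y<z′ =
    sfs-between run (pivotStep-disjoint disjoint) (pivotStep-oneSided p∈S disjoint oneSided) x≢y x<y′ y<z′ x-z-y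

  sfsOrdering-between : ∀ {σ} → IsSFSOrdering A σ →
                        ∀ {x y z} → x ≢ y → x ⟨ σ ⟩< y → y ⟨ σ ⟩< z → Between π x z y → A x z ≤ A x y
  sfsOrdering-between sfs =
    sfs-between sfs (≺-dropEmpty-singleton (allFin n)) (λ _ a≺c _ → ≺-dropEmpty-singleton (allFin n) a≺c)

corollary3p5 : ∀ {n} (A : Matrix n) → Symmetric A → Nonnegative A → Robinsonian A →
    (σ : List (Fin n)) → IsSFSOrdering A σ →
    ∀ x y z → x ≢ y → y ≢ z → x ≢ z → x ⟨ σ ⟩< y → y ⟨ σ ⟩< z →
      (A x z ⊓ A y z ≤ A x y)
      × (∀ π → IsRobinsonOrdering A π → x ⟨ π ⟩< z → z ⟨ π ⟩< y → A x z ≤ A x y ⊓ A y z)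
corollary3p5 A symmetric nonneg (π₀ , robinson₀) σ sfs x y z x≢y y≢z x≢z x<y y<z = part₁ , part₂
  where
  module R₀ = RobinsonSFS A symmetric nonneg robinson₀

  part₁ : A x z ⊓ A y z ≤ A x y
  part₁ with between-trichotomy (proj₁ robinson₀) x≢y y≢z x≢z
  ... | inj₁ y-x-z = ≤-trans (p⊓q≤q (A x z) _) (subst (A y z ≤_) (symmetric y x) (R₀.robinson-between y-x-z))
  ... | inj₂ (inj₁ x-y-z) = ≤-trans (p⊓q≤p _ _) (R₀.robinson-between x-y-z)
  ... | inj₂ (inj₂ x-z-y) = ≤-trans (p⊓q≤p _ _) (R₀.sfsOrdering-between sfs x≢y x<y y<z x-z-y)

  part₂ : ∀ π → IsRobinsonOrdering A π → x ⟨ π ⟩< z → z ⟨ π ⟩< y → A x z ≤ A x y ⊓ A y z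
  part₂ π robinson x<z z<y = ⊓-glb Axz≤Axy (≤-trans Axz≤Axy Axy≤Ayz)
    where
    open RobinsonSFS A symmetric nonneg robinson
    x-z-y : Between π x z y
    x-z-y = inj₁ (x<z , z<y)

    Axz≤Axy : A x z ≤ A x y
    Axz≤Axy = sfsOrdering-between sfs x≢y x<y y<z x-z-y

    Axy≤Ayz : A x y ≤ A y z
    Axy≤Ayz = subst (_≤ A y z) (symmetric y x) (robinson-between (between-sym x-z-y))
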